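{- Let $\lambda$ be a partition and $i$ an integer with $\ell(\lambda)\le i\le m(\lambda)$. Then $\mathrm{Sk}_{\lambda,i}(x)\neq 0$; equivalently, there exists $T\in\mathrm{SYT}(\lambda)$ with $\ell(\mathrm{des}\,T)=i$.
   Context: A (strong) composition of $n$ is a finite sequence $\alpha=(\alpha_1,\dots,\alpha_l)$ of positive integers summing to $n$; $\ell(\alpha)=l$. For $\lambda\vdash n$, $\ell(\lambda)$ is the number of rows and $\mathrm{SYT}(\lambda)$ the set of standard Young tableaux of shape $\lambda$. For $T\in\mathrm{SYT}(\lambda)$, $\mathrm{Des}\,T=\{i\in\{1,\dots,n-1\}: i+1 \text{ lies in a row strictly below the row of } i\}$; if $\mathrm{Des}\,T=\{a_1<\dots<a_k\}$, $\mathrm{des}\,T=(a_1,a_2-a_1,\dots,a_k-a_{k-1},n-a_k)$. $m(\lambda)=\max\{\ell(\mathrm{des}\,T):T\in\mathrm{SYT}(\lambda)\}$. With $f_{\lambda\alpha}=\#\{T\in\mathrm{SYT}(\lambda):\mathrm{des}\,T=\alpha\}$ and $x^\alpha=x_1^{\alpha_1}\cdots x_{\ell(\alpha)}^{\alpha_{\ell(\alpha)}}$, the $i$-skeleton polynomial is $\mathrm{Sk}_{\lambda,i}(x_1,\dots,x_i)=\sum_{\alpha\models n,\ \ell(\alpha)=i}f_{\lambda\alpha}x^\alpha$. -}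

module Defs where

open import Data.Nat using (ℕ; zero; suc; _+_; _∸_; _<_; _≤_; _≥_; _≟_; _<?_)
open import Data.List using (List; []; _∷_; length; map; concat; filter; upTo)
open import Data.Nat.ListAction using (sum)
open import Data.List.Relation.Unary.All using (All)
open import Data.List.Relation.Unary.Linked using (Linked)
open import Data.List.Relation.Binary.Permutation.Propositional using (_↭_)
open import Data.List.Membership.DecPropositional _≟_ using (_∈?_)
open import Data.Product using (_×_; ∃)
open import Data.Unit using (⊤)
open import Data.Empty using (⊥)
open import Relation.Nullary using (yes; no)

IsPartition : List ℕ → Set
IsPartition λ′ = Linked _≥_ λ′ × All (λ x → 0 < x) λ′

size : List ℕ → ℕ
size = sum

numRows : List ℕ → ℕ
numRows = length

-- A filling is given as a list of rows (row 0 is the top row, English notation).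
-- "Below r r'" : row r' sits directly under row r and each entry of r' is
-- strictly larger than the entry of r directly above it (columns increase).
Below : List ℕ → List ℕ → Set
Below _        []       = ⊤
Below []       (_ ∷ _)  = ⊥
Below (a ∷ as) (b ∷ bs) = (a < b) × Below as bs

oneTo : ℕ → List ℕ
oneTo n = map suc (upTo n)

IsSYT : List ℕ → List (List ℕ) → Set
IsSYT λ′ T =
    (map length T ≡ λ′)
  × (concat T ↭ oneTo (size λ′))
  × All (Linked _<_) T
  × Linked Below T
  where open import Relation.Binary.PropositionalEquality using (_≡_)

SYT : List ℕ → Set
SYT λ′ = ∃ λ T → IsSYT λ′ T

rowOf : List (List ℕ) → ℕ → ℕ
rowOf []       k = 0
rowOf (r ∷ rs) k with k ∈? r
... | yes _ = 0
... | no  _ = suc (rowOf rs k)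

Des : ℕ → List (List ℕ) → List ℕ
Des n T = filter (λ i → rowOf T i <? rowOf T (suc i)) (oneTo (n ∸ 1))

diffs : ℕ → List ℕ → ℕ → List ℕ
diffs prev []       n = (n ∸ prev) ∷ []
diffs prev (a ∷ as) n = (a ∸ prev) ∷ diffs a as n

-- des T, a composition of n (the empty composition when n = 0)
des : ℕ → List (List ℕ) → List ℕ
des zero    T = []
des (suc n) T = diffs 0 (Des (suc n) T) (suc n)

desLength : List ℕ → List (List ℕ) → ℕ
desLength λ′ T = length (des (size λ′) T)

IsMaxDesLength : List ℕ → ℕ → Set
IsMaxDesLength λ′ m =
    (∃ λ T → IsSYT λ′ T × desLength λ′ T ≡ m)
  × (∀ T → IsSYT λ′ T → desLength λ′ T ≤ m)
  where open import Relation.Binary.PropositionalEquality using (_≡_)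

-- If y is an entry of the first row of T other than the smallest, then y - 1 is not a descent; hence
-- ℓ(des T) ≤ |λ| - λ₁ + 1 for every T ∈ SYT(λ). Conversely, every i with ℓ(λ) ≤ i ≤ |λ| - λ₁ + 1 is attained,
-- by induction on |λ|: placing the row 1, …, λ₁ on top of a tableau of λ without its first row adds exactly one
-- descent (at λ₁), and placing the column 1, …, ℓ(λ) to the left of a tableau of λ without its first column adds
-- exactly ℓ(λ) - 1 descents; together the two constructions reach the whole interval. Since m(λ) is attained,
-- every i with ℓ(λ) ≤ i ≤ m(λ) lies in it.

module Submission where

open import Defs
open import Data.Nat using (ℕ; zero; suc; pred; _+_; _∸_; _<_; _≤_; _≟_; _<?_; _≤?_; z≤n; s≤s)
open import Data.Nat.Properties
open import Algebra.Properties.CommutativeSemigroup +-commutativeSemigroup using (x∙yz≈y∙xz)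
open import Data.Nat.ListAction using (sum)
open import Data.List using (List; []; _∷_; length; map; concat; filter; applyUpTo; drop; _++_)
open import Data.List.Properties using (length-++; map-++; filter-++; filter-accept; filter-reject; filter-all; filter-none; length-filter; map-applyUpTo; concat-map; length-map; ∷-injective)
open import Data.List.Relation.Unary.All as All using (All; []; _∷_)
import Data.List.Relation.Unary.All.Properties as Allₚ
open import Data.List.Relation.Unary.Any using (here; there)
open import Data.List.Relation.Unary.Linked as Linked using (Linked; []; [-]; _∷_)
import Data.List.Relation.Unary.Linked.Properties as Linkedₚ
open import Data.List.Relation.Binary.Permutation.Propositional using (_↭_; ↭-refl; ↭-sym; ↭-trans; prep; module PermutationReasoning)
import Data.List.Relation.Binary.Permutation.Propositional.Properties as ↭
open import Data.List.Membership.Propositional using (_∈_; _∉_)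
open import Data.List.Membership.Propositional.Properties using (∈-map⁺; ∈-map⁻; ∈-++⁻; ∈-++⁺ˡ; ∈-++⁺ʳ)
open import Data.List.Membership.DecPropositional _≟_ using (_∈?_)
open import Data.Product using (_×_; ∃; _,_; proj₁; proj₂)
open import Data.Sum using (inj₁; inj₂)
open import Data.Unit using (tt)
open import Data.Empty using (⊥-elim)
open import Function using (_∘_; _⇔_; mk⇔; Equivalence)
open import Relation.Nullary using (yes; no; ¬_)
open import Relation.Unary using (Pred; Decidable; ∁)
open import Relation.Binary.PropositionalEquality
open import Induction.WellFounded using (Acc; acc)
open import Data.Nat.Induction using (<-wellFounded)

range : ℕ → ℕ → List ℕ
range s zero    = []
range s (suc k) = s ∷ range (suc s) k

length-range : ∀ s k → length (range s k) ≡ k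
length-range s zero    = refl
length-range s (suc k) = cong suc (length-range (suc s) k)

range-++ : ∀ s k l → range s (k + l) ≡ range s k ++ range (s + k) l
range-++ s zero    l = cong (λ t → range t l) (sym (+-identityʳ s))
range-++ s (suc k) l = cong (s ∷_) (trans (range-++ (suc s) k l)
  (cong (λ t → range (suc s) k ++ range t l) (sym (+-suc s k))))

map-+-range : ∀ c s k → map (_+ c) (range s k) ≡ range (s + c) k
map-+-range c s zero    = refl
map-+-range c s (suc k) = cong (s + c ∷_) (map-+-range c (suc s) k)

applyUpTo≡range : ∀ {f} s n → (∀ i → f i ≡ s + i) → applyUpTo f n ≡ range s n
applyUpTo≡range s zero    f≗ = refl
applyUpTo≡range s (suc n) f≗ = cong₂ _∷_ (trans (f≗ 0) (+-identityʳ s))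
  (applyUpTo≡range (suc s) n (λ i → trans (f≗ (suc i)) (+-suc s i)))

oneTo≡range : ∀ n → oneTo n ≡ range 1 n
oneTo≡range n = trans (map-applyUpTo (λ i → i) suc n) (applyUpTo≡range 1 n (λ _ → refl))

∈-range⁺ : ∀ {s k x} → s ≤ x → x < s + k → x ∈ range s k
∈-range⁺ {s} {zero} {x} s≤x x<s+0 = ⊥-elim (<⇒≱ (subst (x <_) (+-identityʳ s) x<s+0) s≤x)
∈-range⁺ {s} {suc k} {x} s≤x x<s+k with x ≟ s
... | yes refl = here refl
... | no x≢s   = there (∈-range⁺ (≤∧≢⇒< s≤x (x≢s ∘ sym)) (subst (x <_) (+-suc s k) x<s+k))

∈-range⁻ : ∀ {s k x} → x ∈ range s k → s ≤ x × x < s + k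
∈-range⁻ {s} {suc k} (here refl) = ≤-refl , m<m+n s (s≤s z≤n)
∈-range⁻ {s} {suc k} {x} (there x∈) with ∈-range⁻ x∈
... | s<x , x<s+k = <⇒≤ s<x , subst (x <_) (sym (+-suc s k)) x<s+k

range-tail : ∀ {s k x} → s < x → x ∈ range s (suc k) → x ∈ range (suc s) k
range-tail s<s (here refl) = ⊥-elim (<-irrefl refl s<s)
range-tail _   (there x∈)  = x∈

head<tail : ∀ {x xs} → Linked _<_ (x ∷ xs) → All (x <_) xs
head<tail [-]         = []
head<tail (x<y ∷ y<ys) = Linkedₚ.Linked⇒All <-trans x<y y<ys

range-tail-All : ∀ {s k z Z} → s ≤ z → Linked _<_ (z ∷ Z) → All (_∈ range s (suc k)) Z → All (_∈ range (suc s) k) Z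
range-tail-All s≤z z<Z Z∈ = All.zipWith (λ (z<x , x∈) → range-tail (≤-<-trans s≤z z<x) x∈) (head<tail z<Z , Z∈)

range-strictlyIncreasing : ∀ s k → Linked _<_ (range s k)
range-strictlyIncreasing s zero          = []
range-strictlyIncreasing s (suc zero)    = [-]
range-strictlyIncreasing s (suc (suc k)) = ≤-refl ∷ range-strictlyIncreasing (suc s) (suc k)

module _ {p} {P : Pred ℕ p} (P? : Decidable P) where

  length-filter-++ : ∀ xs ys → length (filter P? (xs ++ ys)) ≡ length (filter P? xs) + length (filter P? ys)
  length-filter-++ xs ys = trans (cong length (filter-++ P? xs ys)) (length-++ (filter P? xs))

  length-filter-shift : ∀ {q} {Q : Pred ℕ q} (Q? : Decidable Q) c s k →
    (∀ {y} → y ∈ range s k → P (y + c) ⇔ Q y) →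
    length (filter P? (range (s + c) k)) ≡ length (filter Q? (range s k))
  length-filter-shift Q? c s zero    P⇔Q = refl
  length-filter-shift Q? c s (suc k) P⇔Q with P? (s + c) | Q? s
  ... | yes _ | yes _ = cong suc (length-filter-shift Q? c (suc s) k (P⇔Q ∘ there))
  ... | no  _ | no  _ = length-filter-shift Q? c (suc s) k (P⇔Q ∘ there)
  ... | yes Ps | no ¬Qs = ⊥-elim (¬Qs (Equivalence.to (P⇔Q (here refl)) Ps))
  ... | no ¬Ps | yes Qs = ⊥-elim (¬Ps (Equivalence.from (P⇔Q (here refl)) Qs))

  length-filter-∷≤ : ∀ x xs → length (filter P? (x ∷ xs)) ≤ suc (length (filter P? xs))
  length-filter-∷≤ x xs with P? x
  ... | yes _ = ≤-refl
  ... | no  _ = n≤1+n _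

  length-filter+avoiding≤ : ∀ s k Z → Linked _<_ Z → All (_∈ range s k) Z → All (∁ P) Z →
    length (filter P? (range s k)) + length Z ≤ k
  length-filter+avoiding≤ s k       []      _ _ _ = begin
    length (filter P? (range s k)) + 0 ≡⟨ +-identityʳ _ ⟩
    length (filter P? (range s k))     ≤⟨ length-filter P? (range s k) ⟩
    length (range s k)                 ≡⟨ length-range s k ⟩
    k                                  ∎
    where open ≤-Reasoning
  length-filter+avoiding≤ s zero    (_ ∷ _) _ (() ∷ _) _
  length-filter+avoiding≤ s (suc k) (z ∷ Z) z<Z (z∈ ∷ Z∈) (¬Pz ∷ ¬PZ) with z∈
  ... | here refl rewrite filter-reject P? {xs = range (suc s) k} ¬Pz =
    subst (_≤ suc k) (sym (+-suc _ (length Z)))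
      (s≤s (length-filter+avoiding≤ (suc s) k Z (Linked.tail z<Z) (range-tail-All ≤-refl z<Z Z∈) ¬PZ))
  ... | there z∈′ = begin
    length (filter P? (s ∷ range (suc s) k)) + length (z ∷ Z)
      ≤⟨ +-monoˡ-≤ _ (length-filter-∷≤ s (range (suc s) k)) ⟩
    suc (length (filter P? (range (suc s) k)) + length (z ∷ Z))
      ≤⟨ s≤s (length-filter+avoiding≤ (suc s) k (z ∷ Z) z<Z
                (z∈′ ∷ range-tail-All (proj₁ (∈-range⁻ z∈)) z<Z Z∈) (¬Pz ∷ ¬PZ)) ⟩
    suc k ∎
    where open ≤-Reasoning

IsDescent : List (List ℕ) → ℕ → Set
IsDescent T i = rowOf T i < rowOf T (suc i)

descent? : ∀ T → Decidable (IsDescent T)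
descent? T i = rowOf T i <? rowOf T (suc i)

descentCount : List (List ℕ) → List ℕ → ℕ
descentCount T = length ∘ filter (descent? T)

length-diffs : ∀ prev D n → length (diffs prev D n) ≡ suc (length D)
length-diffs prev []      n = refl
length-diffs prev (a ∷ D) n = cong suc (length-diffs a D n)

desLength≡1+descentCount : ∀ λ′ T {n} → size λ′ ≡ suc n →
  desLength λ′ T ≡ suc (descentCount T (range 1 n))
desLength≡1+descentCount λ′ T {n} size≡ rewrite size≡ =
  trans (length-diffs 0 (Des (suc n) T) (suc n)) (cong (suc ∘ descentCount T) (oneTo≡range n))

rowOf-∈ : ∀ {r rs x} → x ∈ r → rowOf (r ∷ rs) x ≡ 0
rowOf-∈ {r} {rs} {x} x∈r with x ∈? r
... | yes _   = refl
... | no  x∉r = ⊥-elim (x∉r x∈r)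

rowOf-∉ : ∀ {r rs x} → x ∉ r → rowOf (r ∷ rs) x ≡ suc (rowOf rs x)
rowOf-∉ {r} {rs} {x} x∉r with x ∈? r
... | yes x∈r = ⊥-elim (x∉r x∈r)
... | no  _   = refl

rowOf<length : ∀ T {x} → x ∈ concat T → rowOf T x < length T
rowOf<length (r ∷ rs) {x} x∈ with x ∈? r | ∈-++⁻ r x∈
... | yes _   | _         = s≤s z≤n
... | no  x∉r | inj₁ x∈r  = ⊥-elim (x∉r x∈r)
... | no  _   | inj₂ x∈rs = s≤s (rowOf<length rs x∈rs)

descent-∉-firstRow : ∀ {r rs i} → IsDescent (r ∷ rs) i → suc i ∉ r
descent-∉-firstRow {r} {rs} {i} desc i+1∈r = n≮0 (subst (rowOf (r ∷ rs) i <_) (rowOf-∈ i+1∈r) desc)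

∈-SYT⁻ : ∀ {λ′ T x} → IsSYT λ′ T → x ∈ concat T → x ∈ range 1 (size λ′)
∈-SYT⁻ {λ′} (_ , perm , _ , _) x∈ = subst (_ ∈_) (oneTo≡range (size λ′)) (↭.∈-resp-↭ perm x∈)

∈-SYT⁺ : ∀ {λ′ T x} → IsSYT λ′ T → x ∈ range 1 (size λ′) → x ∈ concat T
∈-SYT⁺ {λ′} (_ , perm , _ , _) x∈ = ↭.∈-resp-↭ (↭-sym perm) (subst (_ ∈_) (sym (oneTo≡range (size λ′))) x∈)

-- The bound ℓ(des T) ≤ |λ| - λ₁ + 1

map-pred-tail-strictlyIncreasing : ∀ {x xs} → Linked _<_ (x ∷ xs) → Linked _<_ (map pred xs)
map-pred-tail-strictlyIncreasing [-]                                  = []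
map-pred-tail-strictlyIncreasing (_ ∷ [-])                            = [-]
map-pred-tail-strictlyIncreasing {xs = suc _ ∷ suc _ ∷ _} (_ ∷ y<z ∷ l) =
  ≤-pred y<z ∷ map-pred-tail-strictlyIncreasing (y<z ∷ l)

pred-∈-range : ∀ {y n} → 1 < y → y ∈ range 1 (suc n) → pred y ∈ range 1 n
pred-∈-range {suc zero}    (s≤s ())
pred-∈-range {suc (suc y)} _ y∈ = ∈-range⁺ (s≤s z≤n) (≤-pred (proj₂ (∈-range⁻ y∈)))

desLength+head≤ : ∀ {a μ T} → 0 < a → IsSYT (a ∷ μ) T → desLength (a ∷ μ) T + a ≤ suc (size (a ∷ μ))
desLength+head≤ {T = [] ∷ _} 0<a (shape , _) = ⊥-elim (<-irrefl (proj₁ (∷-injective shape)) 0<a)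
desLength+head≤ {a} {μ} {(x ∷ rest) ∷ ts} _ syt@(shape , _ , x<rest ∷ _ , _) = begin
  desLength (a ∷ μ) T′ + a
    ≡⟨ cong₂ _+_ (desLength≡1+descentCount (a ∷ μ) T′ size≡) (sym a≡) ⟩
  suc (descents + suc (length rest))
    ≡⟨ cong suc (+-suc descents (length rest)) ⟩
  suc (suc (descents + length rest))
    ≡⟨ cong (λ l → suc (suc (descents + l))) (sym (length-map pred rest)) ⟩
  suc (suc (descents + length (map pred rest)))
    ≤⟨ s≤s (s≤s (length-filter+avoiding≤ (descent? T′) 1 n′ (map pred rest) (map-pred-tail-strictlyIncreasing x<rest)
                   (Allₚ.map⁺ (All.tabulate pred∈)) (Allₚ.map⁺ (All.tabulate nonDescent)))) ⟩
  suc (suc n′)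
    ≡⟨ cong suc (sym size≡) ⟩
  suc (size (a ∷ μ)) ∎
  where
  open ≤-Reasoning
  T′ = (x ∷ rest) ∷ ts
  a≡ : suc (length rest) ≡ a
  a≡ = proj₁ (∷-injective shape)
  n′ = length rest + sum μ
  size≡ : size (a ∷ μ) ≡ suc n′
  size≡ = cong (_+ sum μ) (sym a≡)
  descents = descentCount T′ (range 1 n′)
  1<rest : ∀ {y} → y ∈ rest → 1 < y
  1<rest y∈ = ≤-<-trans (proj₁ (∈-range⁻ (∈-SYT⁻ syt (here refl)))) (All.lookup (head<tail x<rest) y∈)
  pred∈ : ∀ {y} → y ∈ rest → pred y ∈ range 1 n′
  pred∈ {y} y∈ = pred-∈-range (1<rest y∈) (subst (λ n → y ∈ range 1 n) size≡ (∈-SYT⁻ syt (there (∈-++⁺ˡ y∈))))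
  nonDescent : ∀ {y} → y ∈ rest → ¬ IsDescent T′ (pred y)
  nonDescent {suc y} y∈ desc = descent-∉-firstRow desc (there y∈)
  nonDescent {zero}  y∈ _    = <⇒≱ (1<rest y∈) z≤n

shift : ℕ → List (List ℕ) → List (List ℕ)
shift c = map (map (_+ c))

rowOf-shift : ∀ c S y → rowOf (shift c S) (y + c) ≡ rowOf S y
rowOf-shift c []      y = refl
rowOf-shift c (r ∷ S) y with y ∈? r
... | yes y∈r = rowOf-∈ (∈-map⁺ (_+ c) y∈r)
... | no  y∉r = trans (rowOf-∉ y+c∉) (cong suc (rowOf-shift c S y))
  where
  y+c∉ : y + c ∉ map (_+ c) r
  y+c∉ y+c∈ with ∈-map⁻ (_+ c) y+c∈
  ... | x , x∈r , y+c≡x+c = y∉r (subst (_∈ r) (sym (+-cancelʳ-≡ c y x y+c≡x+c)) x∈r)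

map-length-shift : ∀ c S → map length (shift c S) ≡ map length S
map-length-shift c []      = refl
map-length-shift c (s ∷ S) = cong₂ _∷_ (length-map (_+ c) s) (map-length-shift c S)

shift-strictlyIncreasing : ∀ c {xs} → Linked _<_ xs → Linked _<_ (map (_+ c) xs)
shift-strictlyIncreasing c = Linkedₚ.map⁺ ∘ Linked.map (+-monoˡ-< c)

shift-rows : ∀ c {S} → All (Linked _<_) S → All (Linked _<_) (shift c S)
shift-rows c = Allₚ.map⁺ ∘ All.map (shift-strictlyIncreasing c)

Below-shift : ∀ c {xs ys} → Below xs ys → Below (map (_+ c) xs) (map (_+ c) ys)
Below-shift c {xs}     {[]}     _         = tt
Below-shift c {x ∷ xs} {y ∷ ys} (x<y , b) = +-monoˡ-< c x<y , Below-shift c b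

shift-columns : ∀ c {S} → Linked Below S → Linked Below (shift c S)
shift-columns c = Linkedₚ.map⁺ ∘ Linked.map (Below-shift c)

Below-range : ∀ s k ys → length ys ≤ k → All (s + k ≤_) ys → Below (range s k) ys
Below-range s k       []       _           _              = tt
Below-range s (suc k) (y ∷ ys) (s≤s |ys|≤k) (s+k<y ∷ s+k≤ys) =
  <-≤-trans (m<m+n s (s≤s z≤n)) s+k<y ,
  Below-range (suc s) k ys |ys|≤k (subst (λ t → All (t ≤_) ys) (+-suc s k) s+k≤ys)

range++shift-↭ : ∀ a n {xs} → xs ↭ oneTo n → range 1 a ++ map (_+ a) xs ↭ oneTo (a + n)
range++shift-↭ a n {xs} xs↭ = begin
  range 1 a ++ map (_+ a) xs          ↭⟨ ↭.++⁺ˡ (range 1 a) (↭.map⁺ (_+ a) xs↭) ⟩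
  range 1 a ++ map (_+ a) (oneTo n)   ≡⟨ cong (λ l → range 1 a ++ map (_+ a) l) (oneTo≡range n) ⟩
  range 1 a ++ map (_+ a) (range 1 n) ≡⟨ cong (range 1 a ++_) (map-+-range a 1 n) ⟩
  range 1 a ++ range (1 + a) n        ≡⟨ sym (range-++ 1 a n) ⟩
  range 1 (a + n)                     ≡⟨ sym (oneTo≡range (a + n)) ⟩
  oneTo (a + n)                       ∎
  where open PermutationReasoning

-- Stacking a row on top

stackRow : ℕ → List (List ℕ) → List (List ℕ)
stackRow a S = range 1 a ∷ shift a S

stackRow-columns : ∀ {a S} → All (_≤ a) (map length S) → (∀ {x} → x ∈ concat S → 1 ≤ x) →
  Linked Below S → Linked Below (stackRow a S)
stackRow-columns {a} {[]}    _           _   _       = [-]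
stackRow-columns {a} {s ∷ _} (|s|≤a ∷ _) 1≤S columns =
  Below-range 1 a (map (_+ a) s) (subst (_≤ a) (sym (length-map (_+ a) s)) |s|≤a)
    (Allₚ.map⁺ (All.tabulate λ y∈ → +-monoˡ-≤ a (1≤S (∈-++⁺ˡ y∈)))) ∷ shift-columns a columns

stackRow-SYT : ∀ {a μ S} → All (_≤ a) μ → IsSYT μ S → IsSYT (a ∷ μ) (stackRow a S)
stackRow-SYT {a} {μ} {S} μ≤a syt@(shape , perm , rows , columns) =
  cong₂ _∷_ (length-range 1 a) (trans (map-length-shift a S) shape) ,
  subst (λ l → range 1 a ++ l ↭ oneTo (a + size μ)) (sym (concat-map S)) (range++shift-↭ a (size μ) perm) ,
  range-strictlyIncreasing 1 a ∷ shift-rows a rows ,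
  stackRow-columns (subst (All (_≤ a)) (sym shape) μ≤a) (proj₁ ∘ ∈-range⁻ ∘ ∈-SYT⁻ syt) columns

stackRow-desLength : ∀ {a μ S k} → size μ ≡ suc k →
  desLength (suc a ∷ μ) (stackRow (suc a) S) ≡ suc (desLength μ S)
stackRow-desLength {a} {μ} {S} {k} size≡ = begin
  desLength (suc a ∷ μ) T
    ≡⟨ desLength≡1+descentCount (suc a ∷ μ) T (cong (suc a +_) size≡) ⟩
  suc (descentCount T (range 1 (a + suc k)))
    ≡⟨ cong (suc ∘ descentCount T) (range-++ 1 a (suc k)) ⟩
  suc (descentCount T (range 1 a ++ suc a ∷ range (2 + a) k))
    ≡⟨ cong suc (length-filter-++ (descent? T) (range 1 a) _) ⟩
  suc (descentCount T (range 1 a) + descentCount T (suc a ∷ range (2 + a) k))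
    ≡⟨ cong₂ (λ m l → suc (m + length l)) (cong length (filter-none (descent? T) (All.tabulate firstRowAscent)))
                                           (filter-accept (descent? T) descentAtEnd) ⟩
  suc (suc (descentCount T (range (1 + suc a) k)))
    ≡⟨ cong (suc ∘ suc) (length-filter-shift (descent? T) (descent? S) (suc a) 1 k shifted) ⟩
  suc (suc (descentCount S (range 1 k)))
    ≡⟨ cong suc (sym (desLength≡1+descentCount μ S size≡)) ⟩
  suc (desLength μ S) ∎
  where
  open ≡-Reasoning
  T = stackRow (suc a) S
  rowOf-below : ∀ y → 1 ≤ y → rowOf T (y + suc a) ≡ suc (rowOf S y)
  rowOf-below y 1≤y = trans (rowOf-∉ (λ y+1+a∈ → <⇒≱ (proj₂ (∈-range⁻ y+1+a∈)) (+-monoˡ-≤ (suc a) 1≤y)))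
                            (cong suc (rowOf-shift (suc a) S y))
  firstRowAscent : ∀ {y} → y ∈ range 1 a → ¬ IsDescent T y
  firstRowAscent y∈ desc = descent-∉-firstRow desc (∈-range⁺ (s≤s z≤n) (s≤s (proj₂ (∈-range⁻ y∈))))
  descentAtEnd : IsDescent T (suc a)
  descentAtEnd = subst₂ _<_ (sym (rowOf-∈ (∈-range⁺ (s≤s z≤n) ≤-refl))) (sym (rowOf-below 1 ≤-refl)) (s≤s z≤n)
  shifted : ∀ {y} → y ∈ range 1 k → IsDescent T (y + suc a) ⇔ IsDescent S y
  shifted {y} y∈ = mk⇔ (λ desc → ≤-pred (subst₂ _<_ (rowOf-below y 1≤y) (rowOf-below (suc y) (s≤s z≤n)) desc))
                       (λ desc → subst₂ _<_ (sym (rowOf-below y 1≤y)) (sym (rowOf-below (suc y) (s≤s z≤n))) (s≤s desc))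
    where 1≤y = proj₁ (∈-range⁻ y∈)

-- Removing and attaching a first column

-- Stops at the first part ≤ 1, which is harmless on partitions: all later parts are 1 as well.
strip : List ℕ → List ℕ
strip (suc (suc x) ∷ xs) = suc x ∷ strip xs
strip _                  = []

IsPartition-tail : ∀ {x xs} → IsPartition (x ∷ xs) → IsPartition xs
IsPartition-tail (decreasing , positive) = Linked.tail decreasing , All.tail positive

IsPartition-head>0 : ∀ {x xs} → IsPartition (x ∷ xs) → 0 < x
IsPartition-head>0 (_ , positive) = All.head positive

IsPartition-head≥ : ∀ {x xs} → IsPartition (x ∷ xs) → All (_≤ x) xs
IsPartition-head≥ ([-] , _)                  = []
IsPartition-head≥ (x≥y ∷ decreasing , _) = Linkedₚ.Linked⇒All (λ y≤x z≤y → ≤-trans z≤y y≤x) x≥y decreasing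

strip-after-1 : ∀ {xs} → IsPartition (1 ∷ xs) → strip xs ≡ []
strip-after-1 {[]}               _                  = refl
strip-after-1 {zero ∷ _}         _                  = refl
strip-after-1 {suc zero ∷ _}     _                  = refl
strip-after-1 {suc (suc _) ∷ _}  (s≤s () ∷ _ , _)

strip-IsPartition : ∀ {λ′} → IsPartition λ′ → IsPartition (strip λ′)
strip-IsPartition {[]}                             _ = [] , []
strip-IsPartition {zero ∷ _}                       _ = [] , []
strip-IsPartition {suc zero ∷ _}                   _ = [] , []
strip-IsPartition {suc (suc _) ∷ []}               _ = [-] , s≤s z≤n ∷ []
strip-IsPartition {suc (suc _) ∷ zero ∷ _}         _ = [-] , s≤s z≤n ∷ []
strip-IsPartition {suc (suc _) ∷ suc zero ∷ _}     _ = [-] , s≤s z≤n ∷ []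
strip-IsPartition {suc (suc _) ∷ suc (suc _) ∷ _}  p@(s≤s x≥y ∷ _ , _) with strip-IsPartition (IsPartition-tail p)
... | decreasing , positive = x≥y ∷ decreasing , s≤s z≤n ∷ positive

size≡length+size-strip : ∀ {λ′} → IsPartition λ′ → size λ′ ≡ length λ′ + size (strip λ′)
size≡length+size-strip {[]}              _ = refl
size≡length+size-strip {suc zero ∷ xs}   p = cong suc (trans (size≡length+size-strip (IsPartition-tail p))
                                                             (cong (λ l → length xs + size l) (strip-after-1 p)))
size≡length+size-strip {suc (suc x) ∷ xs} p = cong suc
  (trans (cong (suc x +_) (size≡length+size-strip (IsPartition-tail p))) (x∙yz≈y∙xz (suc x) (length xs) _))
size≡length+size-strip {zero ∷ _} (_ , () ∷ _)

length-strip≤length : ∀ λ′ → length (strip λ′) ≤ length λ′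
length-strip≤length []                 = z≤n
length-strip≤length (zero ∷ _)         = z≤n
length-strip≤length (suc zero ∷ _)     = z≤n
length-strip≤length (suc (suc _) ∷ xs) = s≤s (length-strip≤length xs)

length-strip≤size-strip : ∀ λ′ → length (strip λ′) ≤ size (strip λ′)
length-strip≤size-strip []                 = z≤n
length-strip≤size-strip (zero ∷ _)         = z≤n
length-strip≤size-strip (suc zero ∷ _)     = z≤n
length-strip≤size-strip (suc (suc x) ∷ xs) = s≤s (≤-trans (length-strip≤size-strip xs) (m≤n+m _ x))

length-strip-∷≤ : ∀ x xs → length (strip (x ∷ xs)) ≤ suc (length (strip xs))
length-strip-∷≤ zero          _ = z≤n
length-strip-∷≤ (suc zero)    _ = z≤n
length-strip-∷≤ (suc (suc _)) _ = ≤-refl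

firstRow : List (List ℕ) → List ℕ
firstRow []      = []
firstRow (s ∷ _) = s

firstRow++rest : ∀ S → firstRow S ++ concat (drop 1 S) ≡ concat S
firstRow++rest []      = refl
firstRow++rest (_ ∷ _) = refl

∈-firstRow : ∀ S {x} → x ∈ firstRow S → x ∈ concat S
∈-firstRow S {x} x∈ = subst (x ∈_) (firstRow++rest S) (∈-++⁺ˡ x∈)

∈-otherRows : ∀ S {x} → x ∈ concat (drop 1 S) → x ∈ concat S
∈-otherRows S {x} x∈ = subst (x ∈_) (firstRow++rest S) (∈-++⁺ʳ (firstRow S) x∈)

-- First column r+1, …, r+ℓ, with the rows of S (possibly fewer than ℓ) shifted by c placed to its right.
attachColumn : ℕ → ℕ → ℕ → List (List ℕ) → List (List ℕ)
attachColumn c r zero    S = []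
attachColumn c r (suc ℓ) S = (suc r ∷ map (_+ c) (firstRow S)) ∷ attachColumn c (suc r) ℓ (drop 1 S)

length-attachedRows≤ : ∀ {λ′} {S : List (List ℕ)} → map length S ≡ strip λ′ → length S ≤ length λ′
length-attachedRows≤ {λ′} {S} shape =
  subst (_≤ length λ′) (trans (cong length (sym shape)) (length-map length S)) (length-strip≤length λ′)

attachColumn-shape : ∀ c r {λ′ S} → IsPartition λ′ → map length S ≡ strip λ′ →
  map length (attachColumn c r (length λ′) S) ≡ λ′
attachColumn-shape c r {[]}                    _ _ = refl
attachColumn-shape c r {suc zero ∷ xs}   {[]}  p _ =
  cong (1 ∷_) (attachColumn-shape c (suc r) (IsPartition-tail p) (sym (strip-after-1 p)))
attachColumn-shape c r {suc (suc x) ∷ xs} {s ∷ S} p shape with ∷-injective shape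
... | |s|≡1+x , shape′ =
  cong₂ _∷_ (cong suc (trans (length-map (_+ c) s) |s|≡1+x)) (attachColumn-shape c (suc r) (IsPartition-tail p) shape′)
attachColumn-shape c r {zero ∷ _} (_ , () ∷ _) _

concat-attachColumn : ∀ c r ℓ S → length S ≤ ℓ →
  concat (attachColumn c r ℓ S) ↭ range (suc r) ℓ ++ map (_+ c) (concat S)
concat-attachColumn c r zero    []      _           = ↭-refl
concat-attachColumn c r (suc ℓ) []      _           = prep (suc r) (concat-attachColumn c (suc r) ℓ [] z≤n)
concat-attachColumn c r (suc ℓ) (s ∷ S) (s≤s |S|≤ℓ) = prep (suc r) (begin
  map (_+ c) s ++ concat (attachColumn c (suc r) ℓ S)
    ↭⟨ ↭.++⁺ˡ (map (_+ c) s) (concat-attachColumn c (suc r) ℓ S |S|≤ℓ) ⟩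
  map (_+ c) s ++ range (2 + r) ℓ ++ map (_+ c) (concat S)
    ↭⟨ ↭.shifts (map (_+ c) s) (range (2 + r) ℓ) ⟩
  range (2 + r) ℓ ++ map (_+ c) s ++ map (_+ c) (concat S)
    ≡⟨ cong (range (2 + r) ℓ ++_) (sym (map-++ (_+ c) s (concat S))) ⟩
  range (2 + r) ℓ ++ map (_+ c) (s ++ concat S) ∎)
  where open PermutationReasoning

+-suc-≤ : ∀ {r ℓ c} → r + suc ℓ ≤ c → suc r + ℓ ≤ c
+-suc-≤ {r} {ℓ} {c} = subst (_≤ c) (+-suc r ℓ)

attachColumn-rows : ∀ c r ℓ S → r + ℓ ≤ c → (∀ {x} → x ∈ concat S → 1 ≤ x) →
  All (Linked _<_) S → All (Linked _<_) (attachColumn c r ℓ S)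
attachColumn-rows c r zero    S       _      _    _         = []
attachColumn-rows c r (suc ℓ) []      r+ℓ≤c  _    _         =
  [-] ∷ attachColumn-rows c (suc r) ℓ [] (+-suc-≤ r+ℓ≤c) (λ ()) []
attachColumn-rows c r (suc ℓ) (s ∷ S) r+ℓ≤c  1≤S  (s↑ ∷ S↑) =
  headRow s (1≤S ∘ ∈-++⁺ˡ) s↑ ∷ attachColumn-rows c (suc r) ℓ S (+-suc-≤ r+ℓ≤c) (1≤S ∘ ∈-++⁺ʳ s) S↑
  where
  headRow : ∀ s′ → (∀ {x} → x ∈ s′ → 1 ≤ x) → Linked _<_ s′ → Linked _<_ (suc r ∷ map (_+ c) s′)
  headRow []       _   _  = [-]
  headRow (y ∷ ys) 1≤s′ s′↑ =
    ≤-trans (s≤s (≤-trans (s≤s (m≤m+n r ℓ)) (+-suc-≤ r+ℓ≤c))) (+-monoˡ-≤ c (1≤s′ (here refl)))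
    ∷ shift-strictlyIncreasing c s′↑

attachColumn-columns : ∀ c r ℓ S → Linked Below S → Linked Below (attachColumn c r ℓ S)
attachColumn-columns c r zero          S            _           = []
attachColumn-columns c r (suc zero)    _            _           = [-]
attachColumn-columns c r (suc (suc ℓ)) []           _           = (≤-refl , tt) ∷ attachColumn-columns c (suc r) (suc ℓ) [] []
attachColumn-columns c r (suc (suc ℓ)) (_ ∷ [])     _           = (≤-refl , tt) ∷ attachColumn-columns c (suc r) (suc ℓ) [] []
attachColumn-columns c r (suc (suc ℓ)) (s ∷ s′ ∷ S) (s↓s′ ∷ S↓) =
  (≤-refl , Below-shift c s↓s′) ∷ attachColumn-columns c (suc r) (suc ℓ) (s′ ∷ S) S↓

rowOf-attachColumn-column : ∀ c r ℓ S d → d < ℓ → r + ℓ ≤ c → (∀ {x} → x ∈ concat S → 1 ≤ x) →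
  rowOf (attachColumn c r ℓ S) (suc (r + d)) ≡ d
rowOf-attachColumn-column c r (suc ℓ) S zero _ _ _ = rowOf-∈ (here (cong suc (+-identityʳ r)))
rowOf-attachColumn-column c r (suc ℓ) S (suc d) (s≤s d<ℓ) r+ℓ≤c 1≤S =
  trans (rowOf-∉ ∉firstRow) (cong suc (trans (cong (λ x → rowOf (attachColumn c (suc r) ℓ (drop 1 S)) (suc x)) (+-suc r d))
    (rowOf-attachColumn-column c (suc r) ℓ (drop 1 S) d d<ℓ (+-suc-≤ r+ℓ≤c) (1≤S ∘ ∈-otherRows S))))
  where
  ∉firstRow : suc (r + suc d) ∉ suc r ∷ map (_+ c) (firstRow S)
  ∉firstRow (here  x≡1+r) = m+1+n≢m r (suc-injective x≡1+r)
  ∉firstRow (there x∈)    with ∈-map⁻ (_+ c) x∈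
  ... | y , y∈ , x≡y+c = <⇒≱ (subst (c <_) (sym x≡y+c) (+-monoˡ-≤ c (1≤S (∈-firstRow S y∈))))
                                (≤-trans (≤-reflexive (sym (+-suc r (suc d)))) (≤-trans (+-monoʳ-≤ r (s≤s d<ℓ)) r+ℓ≤c))

rowOf-attachColumn-shift : ∀ c r ℓ S {y} → 1 ≤ y → y ∈ concat S → length S ≤ ℓ → r + ℓ ≤ c →
  rowOf (attachColumn c r ℓ S) (y + c) ≡ rowOf S y
rowOf-attachColumn-shift c r (suc ℓ) (s ∷ S) {y} 1≤y y∈ (s≤s |S|≤ℓ) r+ℓ≤c with y ∈? s
... | yes y∈s = rowOf-∈ (there (∈-map⁺ (_+ c) y∈s))
... | no  y∉s = trans (rowOf-∉ ∉firstRow)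
  (cong suc (rowOf-attachColumn-shift c (suc r) ℓ S 1≤y y∈S |S|≤ℓ (+-suc-≤ r+ℓ≤c)))
  where
  ∉firstRow : y + c ∉ suc r ∷ map (_+ c) s
  ∉firstRow (here y+c≡1+r) = <⇒≱ (+-monoˡ-≤ c 1≤y)
    (subst (_≤ c) (sym y+c≡1+r) (≤-trans (s≤s (m≤m+n r ℓ)) (+-suc-≤ r+ℓ≤c)))
  ∉firstRow (there y+c∈) with ∈-map⁻ (_+ c) y+c∈
  ... | z , z∈s , y+c≡z+c = y∉s (subst (_∈ s) (sym (+-cancelʳ-≡ c y z y+c≡z+c)) z∈s)
  y∈S : y ∈ concat S
  y∈S with ∈-++⁻ s y∈
  ... | inj₁ y∈s = ⊥-elim (y∉s y∈s)
  ... | inj₂ y∈S = y∈S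

attachColumn-SYT : ∀ {λ′ S} → IsPartition λ′ → IsSYT (strip λ′) S →
  IsSYT λ′ (attachColumn (length λ′) 0 (length λ′) S)
attachColumn-SYT {λ′} {S} p syt@(shape , perm , rows , columns) =
  attachColumn-shape ℓ 0 p shape ,
  subst (concat T ↭_) (cong oneTo (sym (size≡length+size-strip p)))
    (↭-trans (concat-attachColumn ℓ 0 ℓ S (length-attachedRows≤ shape)) (range++shift-↭ ℓ (size (strip λ′)) perm)) ,
  attachColumn-rows ℓ 0 ℓ S ≤-refl (proj₁ ∘ ∈-range⁻ ∘ ∈-SYT⁻ syt) rows ,
  attachColumn-columns ℓ 0 ℓ S columns
  where
  ℓ = length λ′
  T = attachColumn ℓ 0 ℓ S

attachColumn-desLength : ∀ {x xs S k} → IsPartition (x ∷ xs) → IsSYT (strip (x ∷ xs)) S →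
  size (strip (x ∷ xs)) ≡ suc k →
  desLength (x ∷ xs) (attachColumn (suc (length xs)) 0 (suc (length xs)) S) ≡ length xs + desLength (strip (x ∷ xs)) S
attachColumn-desLength {x} {xs} {S} {k} p syt@(shape , _) size≡ = begin
  desLength (x ∷ xs) T
    ≡⟨ desLength≡1+descentCount (x ∷ xs) T size≡′ ⟩
  suc (descentCount T (range 1 (ℓ′ + suc k)))
    ≡⟨ cong (suc ∘ descentCount T) (range-++ 1 ℓ′ (suc k)) ⟩
  suc (descentCount T (range 1 ℓ′ ++ ℓ ∷ range (1 + ℓ) k))
    ≡⟨ cong suc (length-filter-++ (descent? T) (range 1 ℓ′) _) ⟩
  suc (descentCount T (range 1 ℓ′) + descentCount T (ℓ ∷ range (1 + ℓ) k))
    ≡⟨ cong₂ (λ m l → suc (m + length l))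
             (trans (cong length (filter-all (descent? T) (All.tabulate columnDescent))) (length-range 1 ℓ′))
             (filter-reject (descent? T) noDescentAtBottom) ⟩
  suc (ℓ′ + descentCount T (range (1 + ℓ) k))
    ≡⟨ cong (λ m → suc (ℓ′ + m)) (length-filter-shift (descent? T) (descent? S) ℓ 1 k shifted) ⟩
  suc (ℓ′ + descentCount S (range 1 k))
    ≡⟨ sym (+-suc ℓ′ _) ⟩
  ℓ′ + suc (descentCount S (range 1 k))
    ≡⟨ cong (ℓ′ +_) (sym (desLength≡1+descentCount (strip (x ∷ xs)) S size≡)) ⟩
  ℓ′ + desLength (strip (x ∷ xs)) S ∎
  where
  open ≡-Reasoning
  ℓ′ = length xs
  ℓ = suc ℓ′
  T = attachColumn ℓ 0 ℓ S
  size≡′ : size (x ∷ xs) ≡ suc (ℓ′ + suc k)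
  size≡′ = trans (size≡length+size-strip p) (cong (ℓ +_) size≡)
  1≤S : ∀ {y} → y ∈ concat S → 1 ≤ y
  1≤S = proj₁ ∘ ∈-range⁻ ∘ ∈-SYT⁻ syt
  |S|≤ℓ : length S ≤ ℓ
  |S|≤ℓ = length-attachedRows≤ shape
  rowOf-column : ∀ d → d < ℓ → rowOf T (suc d) ≡ d
  rowOf-column d d<ℓ = rowOf-attachColumn-column ℓ 0 ℓ S d d<ℓ ≤-refl 1≤S
  rowOf-right : ∀ y → y ∈ range 1 (suc k) → rowOf T (y + ℓ) ≡ rowOf S y
  ∈S : ∀ {y} → y ∈ range 1 (suc k) → y ∈ concat S
  ∈S {y} = ∈-SYT⁺ syt ∘ subst (λ n → y ∈ range 1 n) (sym size≡)
  rowOf-right y y∈ = rowOf-attachColumn-shift ℓ 0 ℓ S (proj₁ (∈-range⁻ y∈)) (∈S y∈) |S|≤ℓ ≤-refl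
  columnDescent : ∀ {y} → y ∈ range 1 ℓ′ → IsDescent T y
  columnDescent {zero}  y∈ with ∈-range⁻ y∈
  ... | () , _
  columnDescent {suc d} y∈ =
    subst₂ _<_ (sym (rowOf-column d (<-trans d<ℓ′ (n<1+n ℓ′)))) (sym (rowOf-column (suc d) (s≤s d<ℓ′))) ≤-refl
    where d<ℓ′ = ≤-pred (proj₂ (∈-range⁻ y∈))
  noDescentAtBottom : ¬ IsDescent T ℓ
  noDescentAtBottom desc = <⇒≱ (subst₂ _<_ (rowOf-column ℓ′ ≤-refl) (rowOf-right 1 (here refl)) desc)
                              (≤-pred (<-≤-trans (rowOf<length S (∈S (here refl))) |S|≤ℓ))
  shifted : ∀ {y} → y ∈ range 1 k → IsDescent T (y + ℓ) ⇔ IsDescent S y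
  shifted {y} y∈ with ∈-range⁻ y∈
  ... | 1≤y , y≤k = mk⇔ (subst₂ _<_ (rowOf-right y y∈′) (rowOf-right (suc y) y+1∈))
                         (subst₂ _<_ (sym (rowOf-right y y∈′)) (sym (rowOf-right (suc y) y+1∈)))
    where
    y∈′ = ∈-range⁺ 1≤y (<-trans y≤k (n<1+n _))
    y+1∈ = ∈-range⁺ (s≤s z≤n) (s≤s y≤k)

Attained : List ℕ → ℕ → Set
Attained λ′ i = ∃ λ T → IsSYT λ′ T × desLength λ′ T ≡ i

Attained-singleRow : ∀ a → Attained (suc a ∷ []) 1
Attained-singleRow a = T , syt , ≤-antisym desLength≤1 1≤desLength
  where
  T = stackRow (suc a) []
  syt : IsSYT (suc a ∷ []) T
  syt = stackRow-SYT [] (refl , ↭-refl , [] , [])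
  desLength≤1 : desLength (suc a ∷ []) T ≤ 1
  desLength≤1 = +-cancelʳ-≤ (suc a) _ 1
    (subst (desLength (suc a ∷ []) T + suc a ≤_) (cong (suc ∘ suc) (+-identityʳ a)) (desLength+head≤ (s≤s z≤n) syt))
  1≤desLength : 1 ≤ desLength (suc a ∷ []) T
  1≤desLength = subst (1 ≤_) (sym (desLength≡1+descentCount (suc a ∷ []) T refl)) (s≤s z≤n)

Attained-stackRow : ∀ {a μ i k} → All (_≤ suc a) μ → size μ ≡ suc k → Attained μ i → Attained (suc a ∷ μ) (suc i)
Attained-stackRow {a} {μ} μ≤a size≡ (S , syt , desLength≡i) =
  stackRow (suc a) S , stackRow-SYT μ≤a syt , trans (stackRow-desLength {a} {μ} {S} size≡) (cong suc desLength≡i)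

Attained-attachColumn : ∀ {x xs j k} → IsPartition (x ∷ xs) → size (strip (x ∷ xs)) ≡ suc k →
  Attained (strip (x ∷ xs)) j → Attained (x ∷ xs) (length xs + j)
Attained-attachColumn {xs = xs} p size≡ (S , syt , desLength≡j) =
  attachColumn (suc (length xs)) 0 (suc (length xs)) S , attachColumn-SYT p syt ,
  trans (attachColumn-desLength p syt size≡) (cong (length xs +_) desLength≡j)

length+length-strip≤size : ∀ {λ′} → IsPartition λ′ → length λ′ + length (strip λ′) ≤ size λ′
length+length-strip≤size {λ′} p =
  subst (length λ′ + length (strip λ′) ≤_) (sym (size≡length+size-strip p))
    (+-monoʳ-≤ (length λ′) (length-strip≤size-strip λ′))

column-lower-bound : ∀ {a b ν i} → IsPartition (b ∷ ν) → suc (suc (size (b ∷ ν))) < i + b →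
  length (b ∷ ν) + length (strip (suc (suc a) ∷ b ∷ ν)) ≤ i
column-lower-bound {a} {b} {ν} {i} p 2+size<i+b = begin
  length (b ∷ ν) + length (strip (suc (suc a) ∷ b ∷ ν))
    ≤⟨ +-monoʳ-≤ (length (b ∷ ν)) (s≤s (length-strip-∷≤ b ν)) ⟩
  suc (length ν) + suc (suc (length (strip ν)))
    ≡⟨ cong suc (trans (+-suc (length ν) _) (cong suc (+-suc (length ν) _))) ⟩
  3 + (length ν + length (strip ν))
    ≤⟨ +-monoʳ-≤ 3 (length+length-strip≤size (IsPartition-tail p)) ⟩
  3 + size ν
    ≤⟨ +-cancelʳ-≤ b (3 + size ν) i (subst (_≤ i + b) (cong (3 +_) (+-comm b (size ν))) 2+size<i+b) ⟩
  i ∎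
  where open ≤-Reasoning

column-upper-bound : ∀ {x xs j m} → IsPartition (x ∷ xs) → (length xs + j) + suc m ≤ suc (size (x ∷ xs)) →
  j + m ≤ suc (size (strip (x ∷ xs)))
column-upper-bound {x} {xs} {j} {m} p bound = ≤-pred (+-cancelˡ-≤ l _ _ (begin
  l + suc (j + m)                     ≡⟨ cong (l +_) (sym (+-suc j m)) ⟩
  l + (j + suc m)                     ≡⟨ sym (+-assoc l j (suc m)) ⟩
  (l + j) + suc m                     ≤⟨ bound ⟩
  suc (size (x ∷ xs))                 ≡⟨ cong suc (size≡length+size-strip p) ⟩
  suc (suc l + S)                     ≡⟨ cong suc (sym (+-suc l S)) ⟩
  suc (l + suc S)                     ≡⟨ sym (+-suc l (suc S)) ⟩
  l + suc (suc S)                     ∎))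
  where
  open ≤-Reasoning
  l = length xs
  S = size (strip (x ∷ xs))

size-strip< : ∀ {x xs} → IsPartition (x ∷ xs) → size (strip (x ∷ xs)) < size (x ∷ xs)
size-strip< {x} {xs} p = subst (size (strip (x ∷ xs)) <_) (sym (size≡length+size-strip p)) (m<n+m _ (s≤s z≤n))

Attained-interval : ∀ {a μ} i → IsPartition (a ∷ μ) → Acc _<_ (size (a ∷ μ)) →
  length (a ∷ μ) ≤ i → i + a ≤ suc (size (a ∷ μ)) → Attained (a ∷ μ) i
Attained-interval {zero}  _ (_ , () ∷ _) _ _ _
Attained-interval {suc a} {[]} i _ _ 1≤i i+a≤ = subst (Attained (suc a ∷ [])) (≤-antisym 1≤i i≤1) (Attained-singleRow a)
  where
  i≤1 : i ≤ 1
  i≤1 = +-cancelʳ-≤ (suc a) i 1 (subst (i + suc a ≤_) (cong (suc ∘ suc) (+-identityʳ a)) i+a≤)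
Attained-interval {suc a} {zero ∷ _} _ (_ , _ ∷ () ∷ _) _ _ _
Attained-interval {suc a} {suc b ∷ ν} zero _ _ () _
-- The row step needs i - 1 ≤ |μ| - μ₁ + 1; when that fails, column-lower-bound makes the column step applicable.
Attained-interval {suc a} {suc b ∷ ν} (suc i) p (acc smaller) ℓ≤i i+a≤ with suc i + suc b ≤? suc (suc (size (suc b ∷ ν)))
... | yes i+b≤ = Attained-stackRow (IsPartition-head≥ p) refl
  (Attained-interval i (IsPartition-tail p) (smaller (m<n+m _ (s≤s z≤n))) (≤-pred ℓ≤i) (≤-pred i+b≤))
Attained-interval {suc zero}    {suc zero ∷ ν}      (suc i) _ _ _ i+a≤ | no i+b≰ = ⊥-elim (i+b≰ i+a≤)
Attained-interval {suc zero}    {suc (suc _) ∷ _}   _ (s≤s () ∷ _ , _) _ _ _ | no _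
Attained-interval {suc (suc a)} {suc b ∷ ν} (suc i) p (acc smaller) ℓ≤i i+a≤ | no i+b≰ =
  subst (Attained λ′) μ+j≡1+i
    (Attained-attachColumn p refl (Attained-interval j (strip-IsPartition p) (smaller (size-strip< p)) |strip|≤j j+a≤))
  where
  μ = suc b ∷ ν
  λ′ = suc (suc a) ∷ μ
  μ+strip≤1+i : length μ + length (strip λ′) ≤ suc i
  μ+strip≤1+i = column-lower-bound {a} (IsPartition-tail p) (≰⇒> i+b≰)
  j = suc i ∸ length μ
  μ+j≡1+i : length μ + j ≡ suc i
  μ+j≡1+i = m+[n∸m]≡n (≤-trans (m≤m+n (length μ) _) μ+strip≤1+i)
  |strip|≤j : length (strip λ′) ≤ j
  |strip|≤j = +-cancelˡ-≤ (length μ) _ _ (subst (length μ + length (strip λ′) ≤_) (sym μ+j≡1+i) μ+strip≤1+i)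
  j+a≤ : j + suc a ≤ suc (size (strip λ′))
  j+a≤ = column-upper-bound p (subst (λ n → n + suc (suc a) ≤ suc (size λ′)) (sym μ+j≡1+i) i+a≤)

mainTheorem14 : (λ′ : List ℕ) (m i : ℕ) → IsPartition λ′ → IsMaxDesLength λ′ m →
                numRows λ′ ≤ i → i ≤ m →
                ∃ λ T → IsSYT λ′ T × desLength λ′ T ≡ i
mainTheorem14 []      m i _ ((_ , _ , 0≡m) , _) _ i≤m =
  [] , (refl , ↭-refl , [] , []) , sym (n≤0⇒n≡0 (subst (i ≤_) (sym 0≡m) i≤m))
mainTheorem14 (a ∷ μ) m i p ((T , syt , desLength≡m) , _) ℓ≤i i≤m =
  Attained-interval i p (<-wellFounded (size (a ∷ μ))) ℓ≤i (begin
    i + a                   ≤⟨ +-monoˡ-≤ a i≤m ⟩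
    m + a                   ≡⟨ cong (_+ a) (sym desLength≡m) ⟩
    desLength (a ∷ μ) T + a ≤⟨ desLength+head≤ (IsPartition-head>0 p) syt ⟩
    suc (size (a ∷ μ))      ∎)
  where open ≤-Reasoning
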